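{- Let $H$ be a strictly $2$-balanced graph and $p=n^{ -(v_H-2)/(e_H-1)}$. (i) If $d$ is the largest integer for which $np^{d-1}>1$, then $H$ has minimum degree at least $d$. (ii) $p>1/n$, and so $H$ has minimum degree at least $2$. (iii) $H$ is $2$-connected, and if $\{x,y\}$ is a cutset of $H$ then $xy\notin E_H$.
   Context: A graph $H$ with $v_H$ vertices and $e_H$ edges is strictly $2$-balanced if $v_H,e_H\ge3$ and $\frac{e_H-1}{v_H-2}>\frac{e_K-1}{v_K-2}$ for every proper subgraph $K$ of $H$ with $v_K\ge3$ vertices and $e_K$ edges. Here $n>1$. -}

module Defs where

open import Data.Bool using (Bool; true; false; _∧_; _∨_; not; if_then_else_)
open import Data.Nat as ℕ using (ℕ; zero; suc; _∸_; _<ᵇ_)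
open import Data.Fin using (Fin; toℕ; _≟_)
open import Data.List using (List; []; _∷_; allFin; filter; length; map)
open import Data.Nat.ListAction using (sum)
open import Data.Integer as ℤ using (ℤ; +_; _⊖_)
open import Data.Rational.Unnormalised as ℚᵘ using (ℚᵘ; mkℚᵘ; 1ℚᵘ)
open import Data.Product using (_×_; Σ)
open import Relation.Binary.PropositionalEquality using (_≡_)
open import Relation.Nullary using (¬_; ⌊_⌋)

record Graph : Set where
  field
    V     : ℕ
    Adj   : Fin V → Fin V → Bool
    sym   : ∀ i j → Adj i j ≡ Adj j i
    irrfl : ∀ i → Adj i i ≡ false
open Graph public

countFin : (n : ℕ) → (Fin n → Bool) → ℕ
countFin n P = length (filter (λ i → P i ≟b true) (allFin n))
  where
  open import Data.Bool.Properties renaming (_≟_ to _≟b_)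

countPairs : (n : ℕ) → (Fin n → Fin n → Bool) → ℕ
countPairs n R = sum (map (λ i → countFin n (λ j → (toℕ i <ᵇ toℕ j) ∧ R i j)) (allFin n))

vH : Graph → ℕ
vH G = V G

eH : Graph → ℕ
eH G = countPairs (V G) (Adj G)

deg : (G : Graph) → Fin (V G) → ℕ
deg G x = countFin (V G) (Adj G x)

record Subgraph (G : Graph) : Set where
  field
    S      : Fin (V G) → Bool
    F      : Fin (V G) → Fin (V G) → Bool
    F-sym  : ∀ i j → F i j ≡ F j i
    F⊆E    : ∀ i j → F i j ≡ true → Adj G i j ≡ true
    F⊆S×S  : ∀ i j → F i j ≡ true → (S i ≡ true) × (S j ≡ true)
open Subgraph public

vK : {G : Graph} → Subgraph G → ℕ
vK {G} K = countFin (V G) (S K)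

eK : {G : Graph} → Subgraph G → ℕ
eK {G} K = countPairs (V G) (F K)

Proper : {G : Graph} → Subgraph G → Set
Proper {G} K = ¬ ((∀ i → S K i ≡ true) × (∀ i j → F K i j ≡ Adj G i j))

-- the rational number (e - 1)/(v - 2), meaningful for v ≥ 3
-- (mkℚᵘ a k denotes a/(k+1), so the denominator is (v ∸ 3) + 1 = v - 2)
d₂ : (v e : ℕ) → ℚᵘ
d₂ v e = mkℚᵘ (e ⊖ 1) (v ∸ 3)

Strictly2Balanced : Graph → Set
Strictly2Balanced G =
  (3 ℕ.≤ vH G) × (3 ℕ.≤ eH G) ×
  (∀ (K : Subgraph G) → Proper K → 3 ℕ.≤ vK K →
     d₂ (vK K) (eK K) ℚᵘ.< d₂ (vH G) (eH G))

-- p = n^{-(v_H-2)/(e_H-1)} is represented by its logarithm base n: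
-- log_n p = -(v_H - 2)/(e_H - 1)   (meaningful for e_H ≥ 2)
logₙp : Graph → ℚᵘ
logₙp G = ℚᵘ.- mkℚᵘ (+ (vH G ∸ 2)) (eH G ∸ 2)

-- n p^{d-1} > 1  ⇔  log_n (n p^{d-1}) = 1 + (d-1) log_n p > 0   (as n > 1)
npPow>1 : Graph → ℤ → Set
npPow>1 G d = ℚᵘ.0ℚᵘ ℚᵘ.< (1ℚᵘ ℚᵘ.+ (mkℚᵘ (d ℤ.- ℤ.1ℤ) 0 ℚᵘ.* logₙp G))

IsLargestExp : Graph → ℤ → Set
IsLargestExp G d = npPow>1 G d × (∀ d' → npPow>1 G d' → d' ℤ.≤ d)

-- p > 1/n  ⇔  log_n p > log_n (1/n) = -1   (as n > 1)
p>1/n : Graph → Set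
p>1/n G = ℚᵘ.- 1ℚᵘ ℚᵘ.< logₙp G

MinDegreeAtLeast : (G : Graph) → ℤ → Set
MinDegreeAtLeast G d = ∀ x → d ℤ.≤ + deg G x

data Walk (G : Graph) (Sv : Fin (V G) → Bool) : Fin (V G) → Fin (V G) → Set where
  here : ∀ {u} → Sv u ≡ true → Walk G Sv u u
  step : ∀ {u x w} → Sv u ≡ true → Adj G u x ≡ true → Walk G Sv x w → Walk G Sv u w

ConnectedOn : (G : Graph) → (Fin (V G) → Bool) → Set
ConnectedOn G Sv = ∀ u w → Sv u ≡ true → Sv w ≡ true → Walk G Sv u w

minus1 : (G : Graph) → Fin (V G) → Fin (V G) → Bool
minus1 G x u = not ⌊ u ≟ x ⌋

minus2 : (G : Graph) → Fin (V G) → Fin (V G) → Fin (V G) → Bool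
minus2 G x y u = not (⌊ u ≟ x ⌋ ∨ ⌊ u ≟ y ⌋)

-- 2-connected: more than 2 vertices, and G − X connected for every |X| < 2
TwoConnected : Graph → Set
TwoConnected G =
  (3 ℕ.≤ V G) × ConnectedOn G (λ _ → true) × (∀ x → ConnectedOn G (minus1 G x))

IsCutset2 : (G : Graph) → Fin (V G) → Fin (V G) → Set
IsCutset2 G x y = ¬ (x ≡ y) × ¬ ConnectedOn G (minus2 G x y)

{-# OPTIONS --safe #-}
-- Strict 2-balancedness is only ever applied to induced subgraphs H[T] on a proper vertex set T
-- with |T| ≥ 3, in the form e(T)(v − 2) + (|T| − 2) < e(|T| − 2) + (v − 2).
-- Taking T = V ∖ {x} gives e ≤ deg(x)(v − 2) + 1 for every vertex x, which yields (i).
-- Taking T to be a cherry, or two disjoint edges if H is a matching, gives e ≥ v; this is (ii),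
-- and combined with the previous bound it forces minimum degree 2.
-- If deleting a set X of at most two vertices disconnects H and C is a component of H − X,
-- then T = C ∪ X and T = V ∖ C are both admissible; as e(C ∪ X) + e(V ∖ C) = e + e(X),
-- adding their two inequalities forces |X| = 2 and e(X) = 0, which is (iii).
module Submission where

open import Defs hiding (sym)
open import Data.Bool using (Bool; true; false; _∧_; _∨_; not)
open import Data.Bool.Properties using (∧-zeroʳ; ∨-zeroʳ; T-≡) renaming (_≟_ to _≟ᵇ_)
open import Data.Nat using (ℕ; zero; suc; _+_; _*_; _∸_; _≤_; _<_; _≤?_; _<ᵇ_; z≤n; s≤s)
open import Data.Nat.Properties hiding (_≟_)
open import Data.Fin as Fin using (Fin; toℕ; _≟_)
open import Data.Fin.Properties using (toℕ-injective; any?; all?; ¬∀⟶∃¬)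
open import Data.List using (List; []; _∷_; length; filter; tabulate)
open import Data.List.Properties using (map-tabulate)
import Data.Nat.ListAction as ListAction
open import Data.List.Relation.Unary.All using (All; []; _∷_; lookup)
open import Data.List.Relation.Unary.AllPairs using ([]; _∷_)
open import Data.List.Relation.Unary.Any using (here; there)
open import Data.List.Relation.Unary.Unique.Propositional using (Unique)
open import Data.List.Membership.Propositional using (_∈_; _∉_)
open import Data.List.Relation.Unary.All.Properties using (All¬⇒¬Any)
open import Data.Product using (_×_; _,_; ∃; proj₁; proj₂; map₂)
open import Data.Sum using (_⊎_; inj₁; inj₂)
open import Data.Empty using (⊥; ⊥-elim)
open import Function using (_∘_; case_of_; Equivalence)
open import Relation.Binary using (tri<; tri≈; tri>)
open import Relation.Binary.PropositionalEquality
open import Relation.Nullary using (¬_; ⌊_⌋; yes; no; Dec)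
open import Relation.Nullary.Decidable using (dec-true; isYes≗does)
open import Data.Nat.Tactic.RingSolver using (solve-∀)
open import Data.Integer as ℤ using (ℤ; _⊖_)
import Data.Integer.Properties as ℤ
import Data.Integer.Tactic.RingSolver as ℤ-Solver
open import Data.Rational.Unnormalised using (*<*)
open import Algebra.Properties.Semiring.Sum +-*-semiring
  using (sum; sum-syntax; sum-cong-≗; ∑-distrib-+; ∑-comm; *-distribˡ-sum; *-distribʳ-sum)

-- Counting over Fin n

𝟙 : Bool → ℕ
𝟙 true  = 1
𝟙 false = 0

count : (n : ℕ) → (Fin n → Bool) → ℕ
count n P = ∑[ i < n ] 𝟙 (P i)

𝟙≤1 : ∀ b → 𝟙 b ≤ 1
𝟙≤1 true  = s≤s z≤n
𝟙≤1 false = z≤n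

𝟙-∨ : ∀ a b → 𝟙 (a ∨ b) ≤ 𝟙 a + 𝟙 b
𝟙-∨ true  b = s≤s z≤n
𝟙-∨ false b = ≤-refl

witness : ∀ {A : Set} (a? : Dec A) → ⌊ a? ⌋ ≡ true → A
witness (yes a) _ = a

⌊⌋-true : ∀ {A : Set} (a? : Dec A) → A → ⌊ a? ⌋ ≡ true
⌊⌋-true a? a = trans (isYes≗does a?) (dec-true a? a)

≟-refl : ∀ {n} (x : Fin n) → ⌊ x ≟ x ⌋ ≡ true
≟-refl x = ⌊⌋-true (x ≟ x) refl

sum-mono-≤ : ∀ {n} {f g : Fin n → ℕ} → (∀ i → f i ≤ g i) → sum f ≤ sum g
sum-mono-≤ {zero}  f≤g = z≤n
sum-mono-≤ {suc n} f≤g = +-mono-≤ (f≤g Fin.zero) (sum-mono-≤ (f≤g ∘ Fin.suc))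

sum-mono-< : ∀ {n} {f g : Fin n → ℕ} → (∀ i → f i ≤ g i) → ∀ j → f j < g j → sum f < sum g
sum-mono-< f≤g Fin.zero    fj<gj = +-mono-<-≤ fj<gj (sum-mono-≤ (f≤g ∘ Fin.suc))
sum-mono-< f≤g (Fin.suc j) fj<gj = +-mono-≤-< (f≤g Fin.zero) (sum-mono-< (f≤g ∘ Fin.suc) j fj<gj)

sum-const : ∀ n c → ∑[ i < n ] c ≡ n * c
sum-const zero    c = refl
sum-const (suc n) c = cong (c +_) (sum-const n c)

term≤sum : ∀ {n} (f : Fin n → ℕ) j → f j ≤ sum f
term≤sum f Fin.zero    = m≤m+n _ _
term≤sum f (Fin.suc j) = ≤-trans (term≤sum (f ∘ Fin.suc) j) (m≤n+m _ _)

sum-pos : ∀ {n} (f : Fin n → ℕ) → 0 < sum f → ∃ λ i → 0 < f i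
sum-pos {suc n} f 0<Σ with f Fin.zero in eq
... | suc _ = Fin.zero , subst (0 <_) (sym eq) (s≤s z≤n)
... | zero  with sum-pos (f ∘ Fin.suc) 0<Σ
...   | i , 0<fi = Fin.suc i , 0<fi

sum-δ : ∀ {n} (x : Fin n) (f : Fin n → ℕ) → ∑[ i < n ] (𝟙 ⌊ i ≟ x ⌋ * f i) ≡ f x
sum-δ {suc n} Fin.zero    f = begin
  f Fin.zero + 0 + ∑[ i < n ] 0  ≡⟨ cong (f Fin.zero + 0 +_) (trans (sum-const n 0) (*-zeroʳ n)) ⟩
  f Fin.zero + 0 + 0             ≡⟨ trans (+-identityʳ _) (+-identityʳ _) ⟩
  f Fin.zero                     ∎
  where open ≡-Reasoning
sum-δ {suc n} (Fin.suc x) f =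
  trans (sum-cong-≗ λ i → cong (λ b → 𝟙 b * f (Fin.suc i)) (≟-suc i x)) (sum-δ x (f ∘ Fin.suc))
  where
  ≟-suc : ∀ {n} (i x : Fin n) → ⌊ Fin.suc i ≟ Fin.suc x ⌋ ≡ ⌊ i ≟ x ⌋
  ≟-suc i x with i ≟ x
  ... | yes _ = refl
  ... | no  _ = refl

count-all : ∀ n → count n (λ _ → true) ≡ n
count-all n = trans (sum-const n 1) (*-identityʳ n)

count-none : ∀ n → count n (λ _ → false) ≡ 0
count-none n = trans (sum-const n 0) (*-zeroʳ n)

count≤n : ∀ n (P : Fin n → Bool) → count n P ≤ n
count≤n n P = ≤-trans (sum-mono-≤ (𝟙≤1 ∘ P)) (≤-reflexive (count-all n))

count-mono : ∀ n {P Q : Fin n → Bool} → (∀ i → P i ≡ true → Q i ≡ true) → count n P ≤ count n Q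
count-mono n {P} {Q} P⊆Q = sum-mono-≤ pointwise
  where
  pointwise : ∀ i → 𝟙 (P i) ≤ 𝟙 (Q i)
  pointwise i with P i in eq
  ... | false = z≤n
  ... | true  rewrite P⊆Q i eq = ≤-refl

count-∨ : ∀ n {P Q : Fin n → Bool} → (∀ i → P i ≡ true → Q i ≡ false) →
          count n (λ i → P i ∨ Q i) ≡ count n P + count n Q
count-∨ n {P} {Q} disjoint = trans (sum-cong-≗ pointwise) (∑-distrib-+ (𝟙 ∘ P) (𝟙 ∘ Q))
  where
  pointwise : ∀ i → 𝟙 (P i ∨ Q i) ≡ 𝟙 (P i) + 𝟙 (Q i)
  pointwise i with P i in eq
  ... | false = refl
  ... | true  rewrite disjoint i eq = refl

count-not : ∀ n (P : Fin n → Bool) → count n P + count n (not ∘ P) ≡ n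
count-not n P =
  trans (sym (count-∨ n disjoint)) (trans (sum-cong-≗ (cong 𝟙 ∘ excluded-middle ∘ P)) (count-all n))
  where
  disjoint : ∀ i → P i ≡ true → not (P i) ≡ false
  disjoint i eq rewrite eq = refl
  excluded-middle : ∀ b → b ∨ not b ≡ true
  excluded-middle true  = refl
  excluded-middle false = refl

count-witness : ∀ n (P : Fin n → Bool) → 0 < count n P → ∃ λ i → P i ≡ true
count-witness n P 0<count with sum-pos (𝟙 ∘ P) 0<count
... | i , 0<𝟙 = i , 𝟙-pos (P i) 0<𝟙
  where
  𝟙-pos : ∀ b → 0 < 𝟙 b → b ≡ true
  𝟙-pos true _ = refl

not-true : ∀ {b} → not b ≡ true → b ≡ false
not-true {false} _ = refl

count-miss : ∀ n (P : Fin n → Bool) → count n P < n → ∃ λ i → P i ≡ false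
count-miss n P count<n = map₂ not-true (count-witness n (not ∘ P) 0<count¬P)
  where
  0<count¬P : 0 < count n (not ∘ P)
  0<count¬P = +-cancelˡ-< (count n P) 0 _ (subst₂ _<_ (sym (+-identityʳ _)) (sym (count-not n P)) count<n)

count-≟ : ∀ n (x : Fin n) → count n (λ i → ⌊ i ≟ x ⌋) ≡ 1
count-≟ n x = trans (sum-cong-≗ {n} λ i → sym (*-identityʳ _)) (sum-δ x (λ _ → 1))

_∈ᵇ_ : ∀ {n} → Fin n → List (Fin n) → Bool
i ∈ᵇ []       = false
i ∈ᵇ (x ∷ xs) = ⌊ i ≟ x ⌋ ∨ i ∈ᵇ xs

∈ᵇ⇒∈ : ∀ {n} {i : Fin n} xs → i ∈ᵇ xs ≡ true → i ∈ xs
∈ᵇ⇒∈ {i = i} (x ∷ xs) eq with i ≟ x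
... | yes i≡x = here i≡x
... | no  _   = there (∈ᵇ⇒∈ xs eq)

∈⇒∈ᵇ : ∀ {n} {i : Fin n} {xs} → i ∈ xs → i ∈ᵇ xs ≡ true
∈⇒∈ᵇ {i = i} (here refl) rewrite ≟-refl i = refl
∈⇒∈ᵇ {i = i} {x ∷ _} (there i∈xs) rewrite ∈⇒∈ᵇ i∈xs = ∨-zeroʳ ⌊ i ≟ x ⌋

∉⇒∈ᵇ-false : ∀ {n} {i : Fin n} xs → i ∉ xs → i ∈ᵇ xs ≡ false
∉⇒∈ᵇ-false {i = i} xs i∉xs with i ∈ᵇ xs in eq
... | true  = ⊥-elim (i∉xs (∈ᵇ⇒∈ xs eq))
... | false = refl

count-∈ᵇ : ∀ {n} {xs : List (Fin n)} → Unique xs → count n (_∈ᵇ xs) ≡ length xs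
count-∈ᵇ {n} {[]}     []           = count-none n
count-∈ᵇ {n} {x ∷ xs} (x∉xs ∷ xs!) =
  trans (count-∨ n disjoint) (cong₂ _+_ (count-≟ n x) (count-∈ᵇ xs!))
  where
  disjoint : ∀ i → ⌊ i ≟ x ⌋ ≡ true → i ∈ᵇ xs ≡ false
  disjoint i i≡x with witness (i ≟ x) i≡x
  ... | refl = ∉⇒∈ᵇ-false xs (All¬⇒¬Any x∉xs)

count-beyond : ∀ {n} (P : Fin n → Bool) {xs} → Unique xs → length xs < count n P →
               ∃ λ i → P i ≡ true × i ∉ xs
count-beyond {n} P {xs} xs! lt = map₂ split (count-witness n P∖xs 0<count)
  where
  P∖xs : Fin n → Bool
  P∖xs i = P i ∧ not (i ∈ᵇ xs)
  pointwise : ∀ i → 𝟙 (P i) ≤ 𝟙 (P∖xs i) + 𝟙 (i ∈ᵇ xs)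
  pointwise i with P i | i ∈ᵇ xs
  ... | true  | true  = s≤s z≤n
  ... | true  | false = s≤s z≤n
  ... | false | _     = z≤n
  0<count : 0 < count n P∖xs
  0<count = +-cancelʳ-< (length xs) 0 (count n P∖xs) (≤-trans lt (≤-trans (sum-mono-≤ pointwise)
              (≤-reflexive (trans (∑-distrib-+ (𝟙 ∘ P∖xs) _)
                                  (cong (count n P∖xs +_) (count-∈ᵇ xs!))))))
  split : ∀ {i} → P∖xs i ≡ true → P i ≡ true × i ∉ xs
  split {i} eq with P i | i ∈ᵇ xs in i∈ᵇxs
  ... | true | false = refl , λ i∈xs → case trans (sym (∈⇒∈ᵇ i∈xs)) i∈ᵇxs of λ ()

-- Edge counts

<ᵇ-true : ∀ {m n} → m < n → (m <ᵇ n) ≡ true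
<ᵇ-true m<n = Equivalence.to T-≡ (<⇒<ᵇ m<n)

<ᵇ-false : ∀ {m n} → ¬ m < n → (m <ᵇ n) ≡ false
<ᵇ-false {m} {n} m≮n with m <ᵇ n in eq
... | false = refl
... | true  = ⊥-elim (m≮n (<ᵇ⇒< m n (Equivalence.from T-≡ eq)))

length-filter-tabulate : ∀ {A : Set} n (Q : A → Bool) (f : Fin n → A) →
  length (filter (λ a → Q a ≟ᵇ true) (tabulate f)) ≡ ∑[ i < n ] 𝟙 (Q (f i))
length-filter-tabulate zero    Q f = refl
length-filter-tabulate (suc n) Q f with Q (f Fin.zero)
... | true  = cong suc (length-filter-tabulate n Q (f ∘ Fin.suc))
... | false = length-filter-tabulate n Q (f ∘ Fin.suc)

listSum-tabulate : ∀ n (f : Fin n → ℕ) → ListAction.sum (tabulate f) ≡ sum f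
listSum-tabulate zero    f = refl
listSum-tabulate (suc n) f = cong (f Fin.zero +_) (listSum-tabulate n (f ∘ Fin.suc))

countFin≡count : ∀ n P → countFin n P ≡ count n P
countFin≡count n P = length-filter-tabulate n P (λ i → i)

countPairs≡ : ∀ n R → countPairs n R ≡ ∑[ i < n ] count n (λ j → (toℕ i <ᵇ toℕ j) ∧ R i j)
countPairs≡ n R = trans (cong ListAction.sum (map-tabulate (λ i → i) below))
                        (trans (listSum-tabulate n below) (sum-cong-≗ {n} λ i → countFin≡count n _))
  where
  below : Fin n → ℕ
  below i = countFin n (λ j → (toℕ i <ᵇ toℕ j) ∧ R i j)

handshake : ∀ n (R : Fin n → Fin n → Bool) → (∀ i j → R i j ≡ R j i) → (∀ i → R i i ≡ false) →
            2 * countPairs n R ≡ ∑[ i < n ] count n (R i)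
handshake n R R-sym R-irrefl = begin
  2 * countPairs n R                   ≡⟨ cong (2 *_) (countPairs≡ n R) ⟩
  2 * ∑[ i < n ] below i               ≡⟨ cong (∑[ i < n ] below i +_) (+-identityʳ _) ⟩
  ∑[ i < n ] below i + ∑[ i < n ] below i
    ≡⟨ cong (∑[ i < n ] below i +_) (∑-comm (λ i j → 𝟙 ((toℕ i <ᵇ toℕ j) ∧ R i j))) ⟩
  ∑[ i < n ] below i + ∑[ i < n ] ∑[ j < n ] 𝟙 ((toℕ j <ᵇ toℕ i) ∧ R j i)
    ≡⟨ sym (∑-distrib-+ below _) ⟩
  ∑[ i < n ] (below i + ∑[ j < n ] 𝟙 ((toℕ j <ᵇ toℕ i) ∧ R j i))
    ≡⟨ sum-cong-≗ {n} (λ i → trans (sym (∑-distrib-+ {n} _ _)) (sum-cong-≗ {n} (sym ∘ split i))) ⟩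
  ∑[ i < n ] count n (R i)             ∎
  where
  open ≡-Reasoning
  below : Fin n → ℕ
  below i = count n (λ j → (toℕ i <ᵇ toℕ j) ∧ R i j)
  split : ∀ i j → 𝟙 (R i j) ≡ 𝟙 ((toℕ i <ᵇ toℕ j) ∧ R i j) + 𝟙 ((toℕ j <ᵇ toℕ i) ∧ R j i)
  split i j with <-cmp (toℕ i) (toℕ j)
  ... | tri< i<j _ j≮i rewrite <ᵇ-true i<j | <ᵇ-false j≮i = sym (+-identityʳ _)
  ... | tri> i≮j _ j<i rewrite <ᵇ-true j<i | <ᵇ-false i≮j = cong 𝟙 (R-sym i j)
  ... | tri≈ _ i≡j _ rewrite toℕ-injective i≡j | <ᵇ-false (<-irrefl (refl {x = toℕ j})) =
    cong 𝟙 (R-irrefl j)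

induced : (G : Graph) → (Fin (V G) → Bool) → Subgraph G
induced G T = record
  { S     = T
  ; F     = λ i j → T i ∧ (T j ∧ Adj G i j)
  ; F-sym = symmetric
  ; F⊆E   = ⊆E
  ; F⊆S×S = ⊆T×T
  }
  where
  symmetric : ∀ i j → T i ∧ (T j ∧ Adj G i j) ≡ T j ∧ (T i ∧ Adj G j i)
  symmetric i j with T i | T j
  ... | true  | true  = Graph.sym G i j
  ... | true  | false = refl
  ... | false | true  = refl
  ... | false | false = refl
  ⊆E : ∀ i j → T i ∧ (T j ∧ Adj G i j) ≡ true → Adj G i j ≡ true
  ⊆E i j eq with T i | T j
  ... | true | true = eq
  ⊆T×T : ∀ i j → T i ∧ (T j ∧ Adj G i j) ≡ true → (T i ≡ true) × (T j ≡ true)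
  ⊆T×T i j eq with T i | T j
  ... | true | true = refl , refl

arcs : (G : Graph) → (Fin (V G) → Bool) → ℕ
arcs G T = ∑[ i < V G ] count (V G) (F (induced G T) i)

arcs≡2*eK : ∀ G T → arcs G T ≡ 2 * eK (induced G T)
arcs≡2*eK G T = sym (handshake (V G) (F (induced G T)) (F-sym (induced G T)) irrefl)
  where
  irrefl : ∀ i → T i ∧ (T i ∧ Adj G i i) ≡ false
  irrefl i with T i
  ... | true  = irrfl G i
  ... | false = refl

deg≡count : ∀ G x → deg G x ≡ count (V G) (Adj G x)
deg≡count G x = countFin≡count (V G) (Adj G x)

degree-sum : ∀ G → ∑[ i < V G ] deg G i ≡ 2 * eH G
degree-sum G = trans (sum-cong-≗ {V G} (deg≡count G)) (sym (handshake (V G) (Adj G) (Graph.sym G) (irrfl G)))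

vK-induced : ∀ G T → vK (induced G T) ≡ count (V G) T
vK-induced G T = countFin≡count (V G) T

-- The density inequality

⊖1-cross-< : ∀ p q a b → (p ⊖ 1) ℤ.* ℤ.+ a ℤ.< (q ⊖ 1) ℤ.* ℤ.+ b → p * a + b < q * b + a
⊖1-cross-< p q a b lt =
  ℤ.drop‿+<+ (subst₂ ℤ._<_ (sym (shift p a b)) (sym (shift′ q b a))
                           (ℤ.+-monoˡ-< (ℤ.+ a ℤ.+ ℤ.+ b) lt))
  where
  open ≡-Reasoning
  shift : ∀ p a b → ℤ.+ (p * a + b) ≡ (p ⊖ 1) ℤ.* ℤ.+ a ℤ.+ (ℤ.+ a ℤ.+ ℤ.+ b)
  shift p a b = begin
    ℤ.+ (p * a + b)                    ≡⟨ ℤ.pos-+ (p * a) b ⟩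
    ℤ.+ (p * a) ℤ.+ ℤ.+ b              ≡⟨ cong (ℤ._+ ℤ.+ b) (ℤ.pos-* p a) ⟩
    ℤ.+ p ℤ.* ℤ.+ a ℤ.+ ℤ.+ b          ≡⟨ ring (ℤ.+ p) (ℤ.+ a) (ℤ.+ b) ⟩
    (ℤ.+ p ℤ.- ℤ.1ℤ) ℤ.* ℤ.+ a ℤ.+ (ℤ.+ a ℤ.+ ℤ.+ b)
      ≡⟨ cong (λ z → z ℤ.* ℤ.+ a ℤ.+ (ℤ.+ a ℤ.+ ℤ.+ b)) (ℤ.[+m]-[+n]≡m⊖n p 1) ⟩
    (p ⊖ 1) ℤ.* ℤ.+ a ℤ.+ (ℤ.+ a ℤ.+ ℤ.+ b) ∎
    where
    ring : ∀ P A B → P ℤ.* A ℤ.+ B ≡ (P ℤ.- ℤ.1ℤ) ℤ.* A ℤ.+ (A ℤ.+ B)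
    ring = ℤ-Solver.solve-∀
  shift′ : ∀ q b a → ℤ.+ (q * b + a) ≡ (q ⊖ 1) ℤ.* ℤ.+ b ℤ.+ (ℤ.+ a ℤ.+ ℤ.+ b)
  shift′ q b a =
    trans (shift q b a) (cong (λ z → (q ⊖ 1) ℤ.* ℤ.+ b ℤ.+ z) (ℤ.+-comm (ℤ.+ b) (ℤ.+ a)))

-- (e_K − 1)/(v_K − 2) < (e_H − 1)/(v_H − 2), cross-multiplied with the 1's moved across,
-- so that no subtraction other than v ∸ 2 remains.
balanced-density : ∀ {G} → Strictly2Balanced G → (K : Subgraph G) → Proper K → 3 ≤ vK K →
                   eK K * (vH G ∸ 2) + (vK K ∸ 2) < eH G * (vK K ∸ 2) + (vH G ∸ 2)
balanced-density {G} (3≤v , _ , denser) K proper 3≤vK with denser K proper 3≤vK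
... | *<* lt = subst₂ (λ a s → eK K * a + s < eH G * s + a) (suc[m∸3] 3≤v) (suc[m∸3] 3≤vK)
                      (⊖1-cross-< (eK K) (eH G) _ _ lt)
  where
  suc[m∸3] : ∀ {m} → 3 ≤ m → suc (m ∸ 3) ≡ m ∸ 2
  suc[m∸3] 3≤m = sym (+-∸-assoc 1 3≤m)

induced-density : ∀ {G} → Strictly2Balanced G → (T : Fin (V G) → Bool) → ∀ z → T z ≡ false →
                  3 ≤ count (V G) T →
                  eK (induced G T) * (V G ∸ 2) + (count (V G) T ∸ 2) < eH G * (count (V G) T ∸ 2) + (V G ∸ 2)
induced-density {G} balanced T z z∉T 3≤t =
  subst (λ t → eK (induced G T) * (V G ∸ 2) + (t ∸ 2) < eH G * (t ∸ 2) + (V G ∸ 2)) (vK-induced G T)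
    (balanced-density balanced (induced G T) proper (subst (3 ≤_) (sym (vK-induced G T)) 3≤t))
  where
  proper : Proper (induced G T)
  proper (all∈T , _) = case trans (sym (all∈T z)) z∉T of λ ()

-- Degrees

count-minus1 : ∀ G x → count (V G) (minus1 G x) + 1 ≡ V G
count-minus1 G x = trans (+-comm _ 1) (trans (cong (_+ count (V G) (minus1 G x)) (sym (count-≟ (V G) x)))
                                             (count-not (V G) (λ i → ⌊ i ≟ x ⌋)))

arcs-minus1 : ∀ G x → arcs G (minus1 G x) + deg G x + deg G x ≡ 2 * eH G
arcs-minus1 G x = begin
  arcs G (minus1 G x) + deg G x + deg G x
    ≡⟨ cong₂ (λ a b → arcs G (minus1 G x) + a + b) (sym out-of-x) (sym into-x) ⟩
  ∑∑ kept + ∑∑ out + ∑∑ into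
    ≡⟨ sym (trans (∑∑-distrib-+ _ _) (cong (_+ ∑∑ into) (∑∑-distrib-+ _ _))) ⟩
  ∑∑ (λ i j → kept i j + out i j + into i j)
    ≡⟨ sum-cong-≗ {n} (λ i → sum-cong-≗ {n} (sym ∘ split i)) ⟩
  ∑[ i < n ] count n (Adj G i)
    ≡⟨ sym (handshake n (Adj G) (Graph.sym G) (irrfl G)) ⟩
  2 * eH G ∎
  where
  open ≡-Reasoning
  n = V G
  ∑∑ : (Fin n → Fin n → ℕ) → ℕ
  ∑∑ f = ∑[ i < n ] ∑[ j < n ] f i j
  ∑∑-distrib-+ : ∀ f g → ∑∑ (λ i j → f i j + g i j) ≡ ∑∑ f + ∑∑ g
  ∑∑-distrib-+ f g = trans (sum-cong-≗ {n} (λ i → ∑-distrib-+ (f i) (g i))) (∑-distrib-+ {n} _ _)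
  kept out into : Fin n → Fin n → ℕ
  kept i j = 𝟙 (minus1 G x i ∧ (minus1 G x j ∧ Adj G i j))
  out  i j = 𝟙 ⌊ i ≟ x ⌋ * 𝟙 (Adj G i j)
  into i j = 𝟙 ⌊ j ≟ x ⌋ * 𝟙 (Adj G i j)
  split : ∀ i j → 𝟙 (Adj G i j) ≡ kept i j + out i j + into i j
  split i j with i ≟ x | j ≟ x | Adj G i j in eq
  ... | yes refl | yes refl | true  = case trans (sym eq) (irrfl G i) of λ ()
  ... | yes _    | yes _    | false = refl
  ... | yes _    | no _     | true  = refl
  ... | yes _    | no _     | false = refl
  ... | no _     | yes _    | true  = refl
  ... | no _     | yes _    | false = refl
  ... | no _     | no _     | true  = refl
  ... | no _     | no _     | false = refl
  out-of-x : ∑∑ out ≡ deg G x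
  out-of-x = begin
    ∑∑ out
      ≡⟨ sum-cong-≗ {n} (λ i → sym (*-distribˡ-sum (𝟙 ⌊ i ≟ x ⌋) (𝟙 ∘ Adj G i))) ⟩
    ∑[ i < n ] (𝟙 ⌊ i ≟ x ⌋ * count n (Adj G i)) ≡⟨ sum-δ x _ ⟩
    count n (Adj G x)                           ≡⟨ sym (deg≡count G x) ⟩
    deg G x                                     ∎
  into-x : ∑∑ into ≡ deg G x
  into-x = begin
    ∑∑ into                                          ≡⟨ ∑-comm into ⟩
    ∑[ j < n ] ∑[ i < n ] (𝟙 ⌊ j ≟ x ⌋ * 𝟙 (Adj G i j))
      ≡⟨ sum-cong-≗ {n} (λ j → sym (*-distribˡ-sum (𝟙 ⌊ j ≟ x ⌋) (λ i → 𝟙 (Adj G i j)))) ⟩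
    ∑[ j < n ] (𝟙 ⌊ j ≟ x ⌋ * ∑[ i < n ] 𝟙 (Adj G i j)) ≡⟨ sum-δ x _ ⟩
    ∑[ i < n ] 𝟙 (Adj G i x)                         ≡⟨ sum-cong-≗ {n} (λ i → cong 𝟙 (Graph.sym G i x)) ⟩
    count n (Adj G x)                                ≡⟨ sym (deg≡count G x) ⟩
    deg G x                                          ∎

arcs≤t*[t∸1] : ∀ G T → arcs G T ≤ count (V G) T * (count (V G) T ∸ 1)
arcs≤t*[t∸1] G T = ≤-trans (sum-mono-≤ row≤) (≤-reflexive (sym (*-distribʳ-sum (t ∸ 1) (𝟙 ∘ T))))
  where
  n = V G
  t = count n T
  row≤ : ∀ i → count n (F (induced G T) i) ≤ 𝟙 (T i) * (t ∸ 1)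
  row≤ i with T i in i∈T
  ... | false = ≤-reflexive (count-none n)
  ... | true  = subst (count n (λ j → T j ∧ Adj G i j) ≤_) (sym (+-identityʳ (t ∸ 1)))
                      (m+n≤o⇒m≤o∸n _ row+1≤t)
    where
    pointwise : ∀ j → 𝟙 (T j ∧ Adj G i j) + 𝟙 ⌊ j ≟ i ⌋ ≤ 𝟙 (T j)
    pointwise j with j ≟ i
    ... | yes refl rewrite i∈T | irrfl G j = ≤-refl
    ... | no _ with T j | Adj G i j
    ...   | true  | true  = ≤-refl
    ...   | true  | false = z≤n
    ...   | false | _     = z≤n
    row+1≤t : count n (λ j → T j ∧ Adj G i j) + 1 ≤ t
    row+1≤t = subst (_≤ t) (trans (∑-distrib-+ {n} _ _) (cong (count n (λ j → T j ∧ Adj G i j) +_)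
                                                             (count-≟ n i)))
                (sum-mono-≤ pointwise)

cancel-< : ∀ {x y l r} z → x + z ≡ l → y + z ≡ r → l < r → x < y
cancel-< {x} {y} z refl refl = +-cancelʳ-< z x y

deletion-arith : ∀ k δ s → k * suc s + s < (k + δ) * s + suc s → k + δ ≤ δ * suc s
deletion-arith k δ s lt =
  ≤-trans (+-monoˡ-≤ δ (≤-pred k<1+δs)) (≤-reflexive (trans (+-comm (δ * s) δ) (sym (*-suc δ s))))
  where
  k<1+δs : k < suc (δ * s)
  k<1+δs = cancel-< (k * s + s) (lhs k s) (rhs k δ s) lt
    where
    lhs : ∀ k s → k + (k * s + s) ≡ k * suc s + s
    lhs = solve-∀
    rhs : ∀ k δ s → suc (δ * s) + (k * s + s) ≡ (k + δ) * s + suc s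
    rhs = solve-∀

eK-minus1 : ∀ G x → eK (induced G (minus1 G x)) + deg G x ≡ eH G
eK-minus1 G x = *-cancelˡ-≡ _ _ 2 (begin
  2 * (k + δ)                   ≡⟨ double k δ ⟩
  2 * k + δ + δ                 ≡⟨ cong (λ a → a + δ + δ) (sym (arcs≡2*eK G (minus1 G x))) ⟩
  arcs G (minus1 G x) + δ + δ   ≡⟨ arcs-minus1 G x ⟩
  2 * eH G                      ∎)
  where
  open ≡-Reasoning
  k = eK (induced G (minus1 G x))
  δ = deg G x
  double : ∀ k δ → 2 * (k + δ) ≡ 2 * k + δ + δ
  double = solve-∀

eH≤deg*[v∸2]+1 : ∀ {G} → Strictly2Balanced G → ∀ x → eH G ≤ deg G x * (V G ∸ 2) + 1
eH≤deg*[v∸2]+1 {G} balanced@(3≤v , _) x with m≤n⇒m<n∨m≡n 3≤v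
... | inj₁ 3<v = ≤-trans e≤δa (m≤m+n _ 1)
  where
  T′ = induced G (minus1 G x)
  δ = deg G x
  t = count (V G) (minus1 G x)
  s = t ∸ 2
  3≤t : 3 ≤ t
  3≤t = +-cancelʳ-≤ 1 3 t (subst (4 ≤_) (sym (count-minus1 G x)) 3<v)
  s+1≡a : suc s ≡ V G ∸ 2
  s+1≡a = trans (sym (+-∸-assoc 1 (≤-trans (n≤1+n 2) 3≤t)))
                (cong (_∸ 2) (trans (+-comm 1 t) (count-minus1 G x)))
  density = induced-density balanced (minus1 G x) x (cong not (≟-refl x)) 3≤t
  e≤δa : eH G ≤ δ * (V G ∸ 2)
  e≤δa = subst₂ (λ e a → e ≤ δ * a) (eK-minus1 G x) s+1≡a (deletion-arith (eK T′) δ s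
           (subst₂ (λ a e → eK T′ * a + s < e * s + a) (sym s+1≡a) (sym (eK-minus1 G x)) density))
-- For v = 3 the graph V ∖ {x} is too small for the density inequality; count its arcs instead.
... | inj₂ 3≡v = subst (λ a → eH G ≤ deg G x * a + 1) (cong (_∸ 2) 3≡v)
                   (subst (λ a → eH G ≤ a + 1) (sym (*-identityʳ (deg G x))) e≤δ+1)
  where
  δ = deg G x
  t≡2 : count (V G) (minus1 G x) ≡ 2
  t≡2 = +-cancelʳ-≡ 1 _ _ (trans (count-minus1 G x) (sym 3≡v))
  arcs≤2 : arcs G (minus1 G x) ≤ 2
  arcs≤2 = subst (λ t → arcs G (minus1 G x) ≤ t * (t ∸ 1)) t≡2 (arcs≤t*[t∸1] G (minus1 G x))
  e≤δ+1 : eH G ≤ δ + 1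
  e≤δ+1 = *-cancelˡ-≤ 2 (subst₂ _≤_ (arcs-minus1 G x) (twice δ) (+-monoˡ-≤ δ (+-monoˡ-≤ δ arcs≤2)))
    where
    twice : ∀ δ → 2 + δ + δ ≡ 2 * (δ + 1)
    twice = solve-∀

adj⇒≢ : ∀ G {i j} → Adj G i j ≡ true → i ≢ j
adj⇒≢ G {i} i~j refl = case trans (sym i~j) (irrfl G i) of λ ()

adj-sym : ∀ G {i j} → Adj G i j ≡ true → Adj G j i ≡ true
adj-sym G {i} {j} i~j = trans (Graph.sym G j i) i~j

count≤arcs : ∀ G T → (∀ i → T i ≡ true → ∃ λ j → T j ≡ true × Adj G i j ≡ true) →
             count (V G) T ≤ arcs G T
count≤arcs G T no-isolated = sum-mono-≤ pointwise
  where
  pointwise : ∀ i → 𝟙 (T i) ≤ count (V G) (F (induced G T) i)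
  pointwise i with T i in i∈T
  ... | false = z≤n
  ... | true with no-isolated i i∈T
  ...   | j , j∈T , i~j = ≤-trans (≤-reflexive (cong 𝟙 (sym (trans (cong (_∧ Adj G i j) j∈T) i~j))))
                                  (term≤sum (λ j → 𝟙 (T j ∧ Adj G i j)) j)

isolation-free-bound : ∀ {G} → Strictly2Balanced G → (xs : List (Fin (V G))) → Unique xs →
  3 ≤ length xs → length xs < V G → All (λ i → ∃ λ j → j ∈ xs × Adj G i j ≡ true) xs →
  (V G ∸ 2) + (length xs ∸ 2) < eH G * (length xs ∸ 2)
isolation-free-bound {G} balanced xs xs! 3≤t t<v no-isolated =
  two-edges-arith {k} {eH G} (V G ∸ 2) (length xs ∸ 2) 2≤k
    (subst (λ t → k * (V G ∸ 2) + (t ∸ 2) < eH G * (t ∸ 2) + (V G ∸ 2)) t≡ density)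
  where
  T = _∈ᵇ xs
  k = eK (induced G T)
  t≡ : count (V G) T ≡ length xs
  t≡ = count-∈ᵇ xs!
  z∉T = count-miss (V G) T (subst (_< V G) (sym t≡) t<v)
  density = induced-density balanced T (proj₁ z∉T) (proj₂ z∉T) (subst (3 ≤_) (sym t≡) 3≤t)
  3≤2k : 3 ≤ 2 * k
  3≤2k = ≤-trans 3≤t (≤-trans (≤-reflexive (sym t≡)) (subst (count (V G) T ≤_) (arcs≡2*eK G T)
           (count≤arcs G T λ i i∈T →
              map₂ (λ (j∈xs , i~j) → ∈⇒∈ᵇ j∈xs , i~j) (lookup no-isolated (∈ᵇ⇒∈ xs i∈T)))))
  2≤k : 2 ≤ k
  2≤k = ≰⇒> λ k≤1 → <⇒≱ 3≤2k (*-monoʳ-≤ 2 k≤1)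
  two-edges-arith : ∀ {k e} a s → 2 ≤ k → k * a + s < e * s + a → a + s < e * s
  two-edges-arith {k} {e} a s 2≤k lt =
    cancel-< a (regroup a s) refl (≤-<-trans (+-monoˡ-≤ s (*-monoˡ-≤ a 2≤k)) lt)
    where
    regroup : ∀ a s → a + s + a ≡ 2 * a + s
    regroup = solve-∀

neighbour : ∀ G y → 1 ≤ deg G y → ∃ λ a → Adj G y a ≡ true
neighbour G y 1≤deg = count-witness (V G) (Adj G y) (subst (1 ≤_) (deg≡count G y) 1≤deg)

two-neighbours : ∀ G y → 2 ≤ deg G y →
                 ∃ λ a → ∃ λ b → a ≢ b × Adj G y a ≡ true × Adj G y b ≡ true
two-neighbours G y 2≤deg with neighbour G y (≤-trans (s≤s z≤n) 2≤deg)
... | a , y~a with count-beyond (Adj G y) ([] ∷ []) (subst (1 <_) (deg≡count G y) 2≤deg)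
...   | b , y~b , b∉[a] = a , b , (λ a≡b → b∉[a] (here (sym a≡b))) , y~a , y~b

two-neighbours⇒2≤deg : ∀ G y {a b} → a ≢ b → Adj G y a ≡ true → Adj G y b ≡ true → 2 ≤ deg G y
two-neighbours⇒2≤deg G y {a} {b} a≢b y~a y~b =
  subst (2 ≤_) (sym (deg≡count G y))
    (subst (_≤ count (V G) (Adj G y)) (count-∈ᵇ ((a≢b ∷ []) ∷ [] ∷ []))
      (count-mono (V G) λ i i∈ → ∈-cases (∈ᵇ⇒∈ (a ∷ b ∷ []) i∈)))
  where
  ∈-cases : ∀ {i} → i ∈ a ∷ b ∷ [] → Adj G y i ≡ true
  ∈-cases (here refl)         = y~a
  ∈-cases (there (here refl)) = y~b

1≤deg : ∀ {G} → Strictly2Balanced G → ∀ x → 1 ≤ deg G x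
1≤deg {G} balanced@(_ , 3≤e , _) x with deg G x | eH≤deg*[v∸2]+1 balanced x
... | zero  | e≤1 = ⊥-elim (<⇒≱ (≤-trans (n≤1+n 2) 3≤e) e≤1)
... | suc _ | _   = s≤s z≤n

cherry-bound : ∀ {G} → Strictly2Balanced G → 3 < V G → ∀ y → 2 ≤ deg G y → V G ≤ eH G
cherry-bound {G} balanced@(3≤v , _) 3<v y 2≤deg with two-neighbours G y 2≤deg
... | a , b , a≢b , y~a , y~b =
  subst (_≤ eH G) (trans (sym (+-suc (V G ∸ 2) 1)) (m∸n+n≡m (≤-trans (n≤1+n 2) 3≤v)))
    (subst (V G ∸ 2 + 1 <_) (*-identityʳ (eH G))
      (isolation-free-bound balanced (y ∷ a ∷ b ∷ [])
        ((adj⇒≢ G y~a ∷ adj⇒≢ G y~b ∷ []) ∷ (a≢b ∷ []) ∷ [] ∷ []) ≤-refl 3<v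
        ((a , there (here refl) , y~a) ∷ (y , here refl , adj-sym G y~a) ∷ (y , here refl , adj-sym G y~b) ∷ [])))

-- If all degrees are at most 1 then 2e ≤ v, but two disjoint edges ab, cd, of density
-- (2 − 1)/(4 − 2) = 1/2, force v < 2e.
matching-impossible : ∀ {G} → Strictly2Balanced G → (∀ y → deg G y ≤ 1) → ⊥
matching-impossible {G} balanced@(3≤v , 3≤e , _) deg≤1 = <⇒≱ v<2e 2e≤v
  where
  2e≤v : 2 * eH G ≤ V G
  2e≤v = subst₂ _≤_ (degree-sum G) (count-all (V G)) (sum-mono-≤ deg≤1)
  a = Fin.fromℕ< (≤-trans (s≤s z≤n) 3≤v)
  b-ex = neighbour G a (1≤deg balanced a)
  b = proj₁ b-ex
  a~b = proj₂ b-ex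
  a≢b = adj⇒≢ G a~b
  c-ex = count-beyond (λ _ → true) ((a≢b ∷ []) ∷ [] ∷ []) (subst (2 <_) (sym (count-all (V G))) 3≤v)
  c = proj₁ c-ex
  c∉ab = proj₂ (proj₂ c-ex)
  a≢c : a ≢ c
  a≢c a≡c = c∉ab (here (sym a≡c))
  b≢c : b ≢ c
  b≢c b≡c = c∉ab (there (here (sym b≡c)))
  d-ex = neighbour G c (1≤deg balanced c)
  d = proj₁ d-ex
  c~d = proj₂ d-ex
  too-many-neighbours : ∀ {y p q} → p ≢ q → Adj G y p ≡ true → Adj G y q ≡ true → ⊥
  too-many-neighbours {y} p≢q y~p y~q = <⇒≱ (two-neighbours⇒2≤deg G y p≢q y~p y~q) (deg≤1 y)
  c-adj : ∀ {z} → z ≡ d → Adj G c z ≡ true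
  c-adj refl = c~d
  a≢d : a ≢ d
  a≢d a≡d = too-many-neighbours b≢c a~b (adj-sym G (c-adj a≡d))
  b≢d : b ≢ d
  b≢d b≡d = too-many-neighbours a≢c (adj-sym G a~b) (adj-sym G (c-adj b≡d))
  4<v : 4 < V G
  4<v = ≤-trans (n≤1+n 5) (≤-trans (*-monoʳ-≤ 2 3≤e) 2e≤v)
  v<2e : V G < 2 * eH G
  v<2e = subst₂ _<_ (m∸n+n≡m (≤-trans (n≤1+n 2) 3≤v)) (*-comm (eH G) 2)
    (isolation-free-bound balanced (a ∷ b ∷ c ∷ d ∷ [])
      ((a≢b ∷ a≢c ∷ a≢d ∷ []) ∷ (b≢c ∷ b≢d ∷ []) ∷ (adj⇒≢ G c~d ∷ []) ∷ [] ∷ [])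
      (s≤s (s≤s (s≤s z≤n))) 4<v
      ((b , there (here refl) , a~b) ∷ (a , here refl , adj-sym G a~b) ∷
       (d , there (there (there (here refl))) , c~d) ∷ (c , there (there (here refl)) , adj-sym G c~d) ∷ []))

v≤e : ∀ {G} → Strictly2Balanced G → V G ≤ eH G
v≤e {G} balanced@(3≤v , 3≤e , _) with m≤n⇒m<n∨m≡n 3≤v
... | inj₂ 3≡v = subst (_≤ eH G) 3≡v 3≤e
... | inj₁ 3<v with any? (λ y → 2 ≤? deg G y)
...   | yes (y , 2≤deg) = cherry-bound balanced 3<v y 2≤deg
...   | no ∄y           = ⊥-elim (matching-impossible balanced λ y → ≤-pred (≰⇒> (∄y ∘ (y ,_))))

2≤deg : ∀ {G} → Strictly2Balanced G → ∀ x → 2 ≤ deg G x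
2≤deg {G} balanced@(3≤v , _) x = ≰⇒> λ δ≤1 → <⇒≱ (a+1<v) (begin
  V G                         ≤⟨ v≤e balanced ⟩
  eH G                        ≤⟨ eH≤deg*[v∸2]+1 balanced x ⟩
  deg G x * (V G ∸ 2) + 1     ≤⟨ +-monoˡ-≤ 1 (*-monoˡ-≤ (V G ∸ 2) δ≤1) ⟩
  1 * (V G ∸ 2) + 1           ≡⟨ cong (_+ 1) (*-identityˡ (V G ∸ 2)) ⟩
  V G ∸ 2 + 1                 ∎)
  where
  open ≤-Reasoning
  a+1<v : V G ∸ 2 + 1 < V G
  a+1<v = subst (V G ∸ 2 + 1 <_) (m∸n+n≡m (≤-trans (n≤1+n 2) 3≤v)) (+-monoʳ-< (V G ∸ 2) ≤-refl)

-- Connectivity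

walk-snoc : ∀ {G S u i j} → Walk G S u i → Adj G i j ≡ true → S j ≡ true → Walk G S u j
walk-snoc (here u∈S)         i~j j∈S = step u∈S i~j (here j∈S)
walk-snoc (step u∈S u~x walk) i~j j∈S = step u∈S u~x (walk-snoc walk i~j j∈S)

walk-end : ∀ {G S u j} → Walk G S u j → S j ≡ true
walk-end (here j∈S)     = j∈S
walk-end (step _ _ walk) = walk-end walk

-- reach k consists of the vertices reachable from u inside S in at most k steps; it stabilises
-- within V G steps because every step that is not stable adds a vertex.
module Component (G : Graph) (S : Fin (V G) → Bool) (u : Fin (V G)) (u∈S : S u ≡ true) where

  private
    n = V G

  grow : (Fin n → Bool) → Fin n → Bool
  grow R j = R j ∨ (S j ∧ (0 <ᵇ count n (λ i → R i ∧ Adj G i j)))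

  Stable : (Fin n → Bool) → Set
  Stable R = ∀ j → grow R j ≡ R j

  grow-cong : ∀ {R R′} → (∀ i → R i ≡ R′ i) → ∀ j → grow R j ≡ grow R′ j
  grow-cong R≗R′ j = cong₂ _∨_ (R≗R′ j)
    (cong (λ c → S j ∧ (0 <ᵇ c)) (sum-cong-≗ {n} λ i → cong (λ b → 𝟙 (b ∧ Adj G i j)) (R≗R′ i)))

  𝟙-grow : ∀ R j → 𝟙 (R j) ≤ 𝟙 (grow R j)
  𝟙-grow R j with R j
  ... | true  = ≤-refl
  ... | false = z≤n

  𝟙-grow-strict : ∀ R j → grow R j ≢ R j → 𝟙 (R j) < 𝟙 (grow R j)
  𝟙-grow-strict R j changed with R j
  ... | true  = ⊥-elim (changed refl)
  ... | false with S j ∧ (0 <ᵇ count n (λ i → R i ∧ Adj G i j))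
  ...   | true  = ≤-refl
  ...   | false = ⊥-elim (changed refl)

  stable-or-grows : ∀ R → Stable R ⊎ count n R < count n (grow R)
  stable-or-grows R with all? (λ j → grow R j ≟ᵇ R j)
  ... | yes stable = inj₁ stable
  ... | no ¬stable with ¬∀⟶∃¬ n _ (λ j → grow R j ≟ᵇ R j) ¬stable
  ...   | j , changed = inj₂ (sum-mono-< (𝟙-grow R) j (𝟙-grow-strict R j changed))

  reach : ℕ → Fin n → Bool
  reach zero    i = ⌊ i ≟ u ⌋
  reach (suc k) = grow (reach k)

  reach-saturates : ∀ k → Stable (reach k) ⊎ k < count n (reach k)
  reach-saturates zero = inj₂ (subst (0 <_) (sym (count-≟ n u)) ≤-refl)
  reach-saturates (suc k) with reach-saturates k
  ... | inj₁ stable = inj₁ (grow-cong stable)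
  ... | inj₂ k<count with stable-or-grows (reach k)
  ...   | inj₁ stable = inj₁ (grow-cong stable)
  ...   | inj₂ grows  = inj₂ (≤-<-trans k<count grows)

  reach-walk : ∀ k j → reach k j ≡ true → Walk G S u j
  reach-walk zero    j j≡u with witness (j ≟ u) j≡u
  ... | refl = here u∈S
  reach-walk (suc k) j j∈R with reach k j in old
  ... | true  = reach-walk k j old
  ... | false with S j in j∈S | 0 <ᵇ count n (λ i → reach k i ∧ Adj G i j) in new
  ...   | true | true with count-witness n _ (<ᵇ⇒< 0 _ (Equivalence.from T-≡ new))
  ...     | i , i∈R∧i~j with reach k i in i∈R | Adj G i j in i~j
  ...       | true | true = walk-snoc (reach-walk k i i∈R) i~j j∈S

  component : Fin n → Bool
  component = reach n

  component-stable : Stable component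
  component-stable with reach-saturates n
  ... | inj₁ stable = stable
  ... | inj₂ n<count = ⊥-elim (<⇒≱ n<count (count≤n n component))

  component-source : component u ≡ true
  component-source = source n
    where
    source : ∀ k → reach k u ≡ true
    source zero    = ≟-refl u
    source (suc k) rewrite source k = refl

  component-walk : ∀ j → component j ≡ true → Walk G S u j
  component-walk = reach-walk n

  component-closed : ∀ i j → component i ≡ true → S j ≡ true → Adj G i j ≡ true → component j ≡ true
  component-closed i j i∈C j∈S i~j = begin
    component j                                            ≡⟨ component-stable j ⟨
    component j ∨ (S j ∧ (0 <ᵇ count n (λ i → component i ∧ Adj G i j)))
      ≡⟨ cong₂ (λ s b → component j ∨ (s ∧ b)) j∈S (<ᵇ-true 0<count) ⟩
    component j ∨ true                                     ≡⟨ ∨-zeroʳ (component j) ⟩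
    true                                                   ∎
    where
    open ≡-Reasoning
    0<count : 0 < count n (λ i → component i ∧ Adj G i j)
    0<count = ≤-trans (≤-reflexive (cong 𝟙 (sym (trans (cong (_∧ Adj G i j) i∈C) i~j)))) (term≤sum _ i)

closed-neighbourhood : ∀ G T x → T x ≡ true → (∀ j → Adj G x j ≡ true → T j ≡ true) →
                       deg G x + 1 ≤ count (V G) T
closed-neighbourhood G T x x∈T N[x]⊆T =
  subst (_≤ count (V G) T) (trans (∑-distrib-+ {V G} _ _) (cong₂ _+_ (sym (deg≡count G x)) (count-≟ (V G) x)))
    (sum-mono-≤ pointwise)
  where
  pointwise : ∀ j → 𝟙 (Adj G x j) + 𝟙 ⌊ j ≟ x ⌋ ≤ 𝟙 (T j)
  pointwise j with j ≟ x
  ... | yes refl rewrite irrfl G j | x∈T = ≤-refl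
  ... | no _ with Adj G x j in x~j
  ...   | false = z≤n
  ...   | true rewrite N[x]⊆T j x~j = ≤-refl

arcs-split : ∀ ci xi cj xj a → (ci ≡ true → xi ≡ false) → (cj ≡ true → xj ≡ false) →
             (ci ≡ true → cj ≡ false → a ≡ true → xj ≡ true) →
             (cj ≡ true → ci ≡ false → a ≡ true → xi ≡ true) →
             𝟙 ((ci ∨ xi) ∧ ((cj ∨ xj) ∧ a)) + 𝟙 (not ci ∧ (not cj ∧ a)) ≡ 𝟙 a + 𝟙 (xi ∧ (xj ∧ a))
arcs-split true  xi true  xj a     C∩X=∅ _ _ _ rewrite C∩X=∅ refl = refl
arcs-split true  xi false xj true  C∩X=∅ _ closed _ rewrite C∩X=∅ refl | closed refl refl refl = refl
arcs-split true  xi false xj false C∩X=∅ _ _ _ rewrite C∩X=∅ refl | ∧-zeroʳ xj = refl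
arcs-split false xi true  xj true  _ C∩X=∅ _ closed rewrite C∩X=∅ refl | closed refl refl refl = refl
arcs-split false xi true  xj false _ C∩X=∅ _ _ rewrite C∩X=∅ refl | ∧-zeroʳ xi = refl
arcs-split false xi false xj a     _ _ _ _ = +-comm _ (𝟙 a)

separation-arith : ∀ e x a s k → k ≤ 2 → a + 2 ≤ e → s + 2 ≡ a + k →
                   (e + x) * a + s < e * s + 2 * a → k ≡ 2 × x ≡ 0
separation-arith e x a s 2 _ _ s+2≡a+2 lt with +-cancelʳ-≡ 2 s a s+2≡a+2
... | refl = refl , n<1⇒n≡0 (*-cancelʳ-< s x 1 (cancel-< (e * s + s) (l e x s) (r e s) lt))
  where
  l : ∀ e x s → x * s + (e * s + s) ≡ (e + x) * s + s
  l = solve-∀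
  r : ∀ e s → 1 * s + (e * s + s) ≡ e * s + 2 * s
  r = solve-∀
separation-arith e x a s 1 _ a+2≤e s+2≡a+1 lt with +-cancelʳ-≡ 1 a (suc s) (trans (sym s+2≡a+1) (+-suc s 1))
... | refl = ⊥-elim (<⇒≱ (m<n⇒m<1+n e<s+2) a+2≤e)
  where
  l : ∀ e s → e + (e * s + s) ≡ e * suc s + s
  l = solve-∀
  r : ∀ e s → s + 2 + (e * s + s) ≡ e * s + 2 * suc s
  r = solve-∀
  e<s+2 : e < s + 2
  e<s+2 = cancel-< (e * s + s) (l e s) (r e s) (≤-<-trans (+-monoˡ-≤ s (*-monoˡ-≤ a (m≤m+n e x))) lt)
separation-arith e x a s 0 _ a+2≤e s+2≡a lt with trans s+2≡a (+-identityʳ a)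
... | refl = ⊥-elim (<⇒≱ 2e<a+2 (≤-trans a+2≤e (m≤n+m e e)))
  where
  l : ∀ e s → e + e + (e * s + s) ≡ e * (s + 2) + s
  l = solve-∀
  r : ∀ e s → s + 2 + 2 + (e * s + s) ≡ e * s + 2 * (s + 2)
  r = solve-∀
  2e<a+2 : e + e < a + 2
  2e<a+2 = cancel-< (e * s + s) (l e s) (r e s) (≤-<-trans (+-monoˡ-≤ s (*-monoˡ-≤ a (m≤m+n e x))) lt)
separation-arith e x a s (suc (suc (suc k))) (s≤s (s≤s ())) _ _ _

separation : ∀ {G} → Strictly2Balanced G → (X C : Fin (V G) → Bool) → count (V G) X ≤ 2 →
             (∀ i → C i ≡ true → X i ≡ false) →
             (∀ i j → C i ≡ true → X j ≡ false → Adj G i j ≡ true → C j ≡ true) →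
             ∀ u w → C u ≡ true → C w ≡ false → X w ≡ false →
             count (V G) X ≡ 2 × eK (induced G X) ≡ 0
separation {G} balanced@(3≤v , _) X C k≤2 C∩X=∅ closed u w u∈C w∉C w∉X =
  separation-arith (eH G) (eK (induced G X)) a (p + q) k k≤2 a+2≤e sizes
    (subst₂ _<_ regroupˡ (regroupʳ (eH G) a p q)
      (+-mono-< density-A density-B))
  where
  open ≡-Reasoning
  n = V G
  A B : Fin n → Bool
  A i = C i ∨ X i
  B i = not (C i)
  k = count n X
  a = n ∸ 2
  p = count n A ∸ 2
  q = count n B ∸ 2

  a+2≡v : a + 2 ≡ n
  a+2≡v = m∸n+n≡m (≤-trans (n≤1+n 2) 3≤v)
  a+2≤e : a + 2 ≤ eH G
  a+2≤e = subst (_≤ eH G) (sym a+2≡v) (v≤e balanced)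

  C-exits-into-X : ∀ i j → C i ≡ true → C j ≡ false → Adj G i j ≡ true → X j ≡ true
  C-exits-into-X i j i∈C j∉C i~j with X j in j∈X
  ... | true  = refl
  ... | false = case trans (sym (closed i j i∈C j∈X i~j)) j∉C of λ ()

  3≤A : 3 ≤ count n A
  3≤A = ≤-trans (+-monoˡ-≤ 1 (2≤deg balanced u)) (closed-neighbourhood G A u (cong (_∨ X u) u∈C) N[u]⊆A)
    where
    N[u]⊆A : ∀ j → Adj G u j ≡ true → A j ≡ true
    N[u]⊆A j u~j with C j in j∈C
    ... | true  = refl
    ... | false = C-exits-into-X u j u∈C j∈C u~j
  3≤B : 3 ≤ count n B
  3≤B = ≤-trans (+-monoˡ-≤ 1 (2≤deg balanced w)) (closed-neighbourhood G B w (cong not w∉C) N[w]⊆B)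
    where
    N[w]⊆B : ∀ j → Adj G w j ≡ true → B j ≡ true
    N[w]⊆B j w~j with C j in j∈C
    ... | false = refl
    ... | true  = case trans (sym (closed j w j∈C w∉X (adj-sym G w~j))) w∉C of λ ()

  density-A = induced-density balanced A w (cong₂ _∨_ w∉C w∉X) 3≤A
  density-B = induced-density balanced B u (cong not u∈C) 3≤B

  sizes : p + q + 2 ≡ a + k
  sizes = +-cancelʳ-≡ 2 _ _ (begin
    p + q + 2 + 2              ≡⟨ shuffle p q ⟩
    (p + 2) + (q + 2)
      ≡⟨ cong₂ _+_ (m∸n+n≡m (≤-trans (n≤1+n 2) 3≤A)) (m∸n+n≡m (≤-trans (n≤1+n 2) 3≤B)) ⟩
    count n A + count n B      ≡⟨ cong (_+ count n B) (count-∨ n C∩X=∅) ⟩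
    count n C + k + count n B  ≡⟨ swapʳ (count n C) k (count n B) ⟩
    count n C + count n B + k  ≡⟨ cong (_+ k) (count-not n C) ⟩
    n + k                      ≡⟨ cong (_+ k) (sym a+2≡v) ⟩
    a + 2 + k                  ≡⟨ swapʳ a 2 k ⟩
    a + k + 2                  ∎)
    where
    shuffle : ∀ p q → p + q + 2 + 2 ≡ (p + 2) + (q + 2)
    shuffle = solve-∀
    swapʳ : ∀ x y z → x + y + z ≡ x + z + y
    swapʳ = solve-∀

  edges : eK (induced G A) + eK (induced G B) ≡ eH G + eK (induced G X)
  edges = *-cancelˡ-≡ _ _ 2 (begin
    2 * (eK (induced G A) + eK (induced G B))        ≡⟨ *-distribˡ-+ 2 (eK (induced G A)) _ ⟩
    2 * eK (induced G A) + 2 * eK (induced G B)      ≡⟨ cong₂ _+_ (arcs≡2*eK G A) (arcs≡2*eK G B) ⟨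
    arcs G A + arcs G B                              ≡⟨ arcs-A+B ⟩
    ∑[ i < n ] count n (Adj G i) + arcs G X
      ≡⟨ cong₂ _+_ (handshake n (Adj G) (Graph.sym G) (irrfl G)) (sym (arcs≡2*eK G X)) ⟨
    2 * eH G + 2 * eK (induced G X)                  ≡⟨ *-distribˡ-+ 2 (eH G) _ ⟨
    2 * (eH G + eK (induced G X))                    ∎)
    where
    arcs-A+B : arcs G A + arcs G B ≡ ∑[ i < n ] count n (Adj G i) + arcs G X
    arcs-A+B = trans (sym (∑-distrib-+ {n} _ _)) (trans (sum-cong-≗ {n} (λ i →
                 trans (sym (∑-distrib-+ {n} _ _)) (trans (sum-cong-≗ {n} (λ j →
                   arcs-split (C i) (X i) (C j) (X j) (Adj G i j) (C∩X=∅ i) (C∩X=∅ j) (C-exits-into-X i j)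
                     (λ j∈C i∉C j~i → C-exits-into-X j i j∈C i∉C (adj-sym G j~i))))
                 (∑-distrib-+ {n} _ _))))
               (∑-distrib-+ {n} _ _))

  regroupˡ : eK (induced G A) * a + p + (eK (induced G B) * a + q) ≡ (eH G + eK (induced G X)) * a + (p + q)
  regroupˡ = trans (regroup (eK (induced G A)) (eK (induced G B)) a p q) (cong (λ z → z * a + (p + q)) edges)
    where
    regroup : ∀ eA eB a p q → eA * a + p + (eB * a + q) ≡ (eA + eB) * a + (p + q)
    regroup = solve-∀
  regroupʳ : ∀ e a p q → e * p + a + (e * q + a) ≡ e * (p + q) + 2 * a
  regroupʳ = solve-∀

connected-unless-separated : ∀ {G} → Strictly2Balanced G → (X : Fin (V G) → Bool) → count (V G) X ≤ 2 →
  ¬ (count (V G) X ≡ 2 × eK (induced G X) ≡ 0) → ConnectedOn G (λ i → not (X i))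
connected-unless-separated {G} balanced X k≤2 not-separated u w u∉X w∉X = walk-to-w
  where
  open Component G (λ i → not (X i)) u u∉X
  C∩X=∅ : ∀ i → component i ≡ true → X i ≡ false
  C∩X=∅ i i∈C = not-true (walk-end (component-walk i i∈C))
  closed : ∀ i j → component i ≡ true → X j ≡ false → Adj G i j ≡ true → component j ≡ true
  closed i j i∈C j∉X = component-closed i j i∈C (cong not j∉X)
  walk-to-w : Walk G (λ i → not (X i)) u w
  walk-to-w with component w in w∈C
  ... | true  = component-walk w w∈C
  ... | false = ⊥-elim (not-separated
                  (separation balanced X component k≤2 C∩X=∅ closed u w component-source w∈C (not-true w∉X)))

two-connected : ∀ {G} → Strictly2Balanced G → TwoConnected G
two-connected {G} balanced@(3≤v , _) = 3≤v , connected , connected-minus1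
  where
  n = V G
  connected : ConnectedOn G (λ _ → true)
  connected = connected-unless-separated balanced (λ _ → false) (≤-trans (≤-reflexive (count-none n)) z≤n)
                λ (k≡2 , _) → case trans (sym (count-none n)) k≡2 of λ ()
  connected-minus1 : ∀ x → ConnectedOn G (minus1 G x)
  connected-minus1 x =
    connected-unless-separated balanced (λ i → ⌊ i ≟ x ⌋) (≤-trans (≤-reflexive (count-≟ n x)) (s≤s z≤n))
      λ (k≡2 , _) → case trans (sym (count-≟ n x)) k≡2 of λ ()

cutset-non-adjacent : ∀ {G} → Strictly2Balanced G → ∀ x y → IsCutset2 G x y → Adj G x y ≡ false
cutset-non-adjacent {G} balanced x y (_ , disconnected) with Adj G x y in x~y
... | false = refl
... | true  = ⊥-elim (disconnected (connected-unless-separated balanced X k≤2 not-separated))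
  where
  n = V G
  X : Fin n → Bool
  X i = ⌊ i ≟ x ⌋ ∨ ⌊ i ≟ y ⌋
  k≤2 : count n X ≤ 2
  k≤2 = ≤-trans (sum-mono-≤ λ i → 𝟙-∨ ⌊ i ≟ x ⌋ ⌊ i ≟ y ⌋)
                (≤-reflexive (trans (∑-distrib-+ {n} _ _) (cong₂ _+_ (count-≟ n x) (count-≟ n y))))
  x∈X : X x ≡ true
  x∈X = cong (_∨ ⌊ x ≟ y ⌋) (≟-refl x)
  y∈X : X y ≡ true
  y∈X = trans (cong (⌊ y ≟ x ⌋ ∨_) (≟-refl y)) (∨-zeroʳ _)
  no-isolated : ∀ i → X i ≡ true → ∃ λ j → X j ≡ true × Adj G i j ≡ true
  no-isolated i i∈X with i ≟ x
  ... | yes refl = y , y∈X , x~y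
  ... | no  _ with witness (i ≟ y) i∈X
  ...   | refl = x , x∈X , adj-sym G x~y
  not-separated : ¬ (count n X ≡ 2 × eK (induced G X) ≡ 0)
  not-separated (k≡2 , eX≡0) = <⇒≱ (s≤s z≤n) (begin
    2                      ≡⟨ k≡2 ⟨
    count n X              ≤⟨ count≤arcs G X no-isolated ⟩
    arcs G X               ≡⟨ arcs≡2*eK G X ⟩
    2 * eK (induced G X)   ≡⟨ cong (2 *_) eX≡0 ⟩
    0                      ∎)
    where open ≤-Reasoning

-- The exponent conditions

exponent-bound : ∀ G d → npPow>1 G d → (d ℤ.- ℤ.1ℤ) ℤ.* ℤ.+ (V G ∸ 2) ℤ.< ℤ.+ suc (eH G ∸ 2)
exponent-bound G d (*<* lt) =
  subst (λ t → (d ℤ.- ℤ.1ℤ) ℤ.* ℤ.+ (V G ∸ 2) ℤ.< ℤ.+ suc t) (+-identityʳ _)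
    (unfold (ℤ.+ suc (eH G ∸ 2 + 0)) (d ℤ.- ℤ.1ℤ) (ℤ.+ (V G ∸ 2)) lt)
  where
  -- lt is 0 < 1 + (d − 1)·(−(v − 2)/(e − 1)) with the operations of ℚᵘ unfolded.
  unfold : ∀ K D A → ℤ.0ℤ ℤ.* (ℤ.1ℤ ℤ.* K) ℤ.< (ℤ.1ℤ ℤ.* K ℤ.+ (D ℤ.* (ℤ.- A)) ℤ.* ℤ.1ℤ) ℤ.* ℤ.1ℤ →
           D ℤ.* A ℤ.< K
  unfold K D A lt =
    subst₂ ℤ._<_ (l₂ D A) (l₃ K D A) (ℤ.+-monoˡ-< (D ℤ.* A) (subst₂ ℤ._<_ (l₀ K) (l₁ K D A) lt))
    where
    l₀ : ∀ K → ℤ.0ℤ ℤ.* (ℤ.1ℤ ℤ.* K) ≡ ℤ.0ℤ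
    l₀ = ℤ-Solver.solve-∀
    l₁ : ∀ K D A → (ℤ.1ℤ ℤ.* K ℤ.+ (D ℤ.* (ℤ.- A)) ℤ.* ℤ.1ℤ) ℤ.* ℤ.1ℤ ≡ K ℤ.- D ℤ.* A
    l₁ = ℤ-Solver.solve-∀
    l₂ : ∀ D A → ℤ.0ℤ ℤ.+ D ℤ.* A ≡ D ℤ.* A
    l₂ = ℤ-Solver.solve-∀
    l₃ : ∀ K D A → K ℤ.- D ℤ.* A ℤ.+ D ℤ.* A ≡ K
    l₃ = ℤ-Solver.solve-∀

deg≥exponent : ∀ {G} → Strictly2Balanced G → ∀ d → npPow>1 G d → MinDegreeAtLeast G d
deg≥exponent {G} balanced@(_ , 3≤e , _) d np x =
  subst (ℤ._≤ ℤ.+ deg G x) (1+[d-1]≡d d) (ℤ.i<j⇒suc[i]≤j d-1<deg)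
  where
  a = V G ∸ 2
  e-1≤deg*a : suc (eH G ∸ 2) ≤ deg G x * a
  e-1≤deg*a = +-cancelʳ-≤ 1 _ _ (subst (_≤ deg G x * a + 1)
                (trans (sym (m∸n+n≡m (≤-trans (n≤1+n 2) 3≤e))) (+-suc (eH G ∸ 2) 1))
                (eH≤deg*[v∸2]+1 balanced x))
  d-1<deg : d ℤ.- ℤ.1ℤ ℤ.< ℤ.+ deg G x
  d-1<deg = ℤ.*-cancelʳ-<-nonNeg (ℤ.+ a) (ℤ.<-≤-trans (exponent-bound G d np)
              (subst (ℤ.+ suc (eH G ∸ 2) ℤ.≤_) (ℤ.pos-* (deg G x) a) (ℤ.+≤+ e-1≤deg*a)))
  1+[d-1]≡d : ∀ d → ℤ.1ℤ ℤ.+ (d ℤ.- ℤ.1ℤ) ≡ d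
  1+[d-1]≡d = ℤ-Solver.solve-∀

p>1/n-holds : ∀ {G} → Strictly2Balanced G → p>1/n G
p>1/n-holds {G} balanced =
  *<* (negate (ℤ.+ suc (eH G ∸ 2)) (ℤ.+ (V G ∸ 2)) (ℤ.+<+ (s≤s (∸-monoˡ-≤ 2 (v≤e balanced)))))
  where
  negate : ∀ K A → A ℤ.< K → (ℤ.- ℤ.1ℤ) ℤ.* K ℤ.< (ℤ.- A) ℤ.* ℤ.1ℤ
  negate K A A<K = subst₂ ℤ._<_ (l₁ K) (l₂ A) (ℤ.neg-mono-< A<K)
    where
    l₁ : ∀ K → ℤ.- K ≡ (ℤ.- ℤ.1ℤ) ℤ.* K
    l₁ = ℤ-Solver.solve-∀
    l₂ : ∀ A → ℤ.- A ≡ (ℤ.- A) ℤ.* ℤ.1ℤ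
    l₂ = ℤ-Solver.solve-∀

open import Data.Integer using (+_)

-- p = n^{-(v_H-2)/(e_H-1)} is encoded by its base-n logarithm.
lemma3p1 : (n : ℕ) → 1 < n → (H : Graph) → Strictly2Balanced H →
      (∀ (d : ℤ) → IsLargestExp H d → MinDegreeAtLeast H d)
    × (p>1/n H × MinDegreeAtLeast H (+ 2))
    × (TwoConnected H × (∀ x y → IsCutset2 H x y → Adj H x y ≡ false))
lemma3p1 _ _ H balanced =
    (λ d (np , _) → deg≥exponent balanced d np)
  , (p>1/n-holds balanced , λ x → ℤ.+≤+ (2≤deg balanced x))
  , (two-connected balanced , cutset-non-adjacent balanced)
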